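{- Let $t\ge 1$ and $k\ge 4$ be integers, and set $n_k=\frac{2^{kt+2}+2^{k}-5}{2^k-1}$ and $n_{k-1}=2^{kt+2}-3$. Then there is no vector space partition of $\mathbb{F}_2^{k(t+1)+1}$ of type $k^{n_k}\,(k-1)^{n_{k-1}}\,1^{1+2^{k-1}}$, i.e., consisting of exactly $n_k$ subspaces of dimension $k$, $n_{k-1}$ subspaces of dimension $k-1$, and $1+2^{k-1}$ subspaces of dimension $1$ (and no others).
   Context: A vector space partition of $\mathbb{F}_q^n$ is a collection of nonzero subspaces of $\mathbb{F}_q^n$ such that every nonzero vector of $\mathbb{F}_q^n$ lies in exactly one member of the collection. Its type $k^{m_k}\cdots 1^{m_1}$ records that it contains exactly $m_d$ subspaces of dimension $d$ for each $d$ (factors with $m_d=0$ are omitted). -}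

module Defs where

open import Data.Bool using (Bool; true; false; _xor_; _∧_)
open import Data.Nat using (ℕ; zero; suc; _+_; _≤_; _≟_)
open import Relation.Nullary using (yes; no)
open import Data.Fin using (Fin; zero; suc)
open import Data.Vec using (Vec; []; _∷_; zipWith; replicate; map)
open import Data.Product using (Σ; _×_; _,_; proj₁; proj₂)
open import Data.List using (List; []; _∷_)
open import Data.List.Relation.Unary.All using (All)
open import Data.List.Relation.Unary.Any using (Any)
open import Relation.Binary.PropositionalEquality using (_≡_; _≢_)

-- F₂ is modelled by Bool (xor = addition, ∧ = multiplication);
-- vectors of F₂ⁿ are Vec Bool n.
F2Vec : ℕ → Set
F2Vec n = Vec Bool n

0ᵥ : ∀ {n} → F2Vec n
0ᵥ = replicate _ false

_+ᵥ_ : ∀ {n} → F2Vec n → F2Vec n → F2Vec n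
_+ᵥ_ = zipWith _xor_

_·ᵥ_ : ∀ {n} → Bool → F2Vec n → F2Vec n
c ·ᵥ v = map (c ∧_) v

lincomb : ∀ {n d} → Vec Bool d → Vec (F2Vec n) d → F2Vec n
lincomb [] [] = 0ᵥ
lincomb (c ∷ cs) (b ∷ bs) = (c ·ᵥ b) +ᵥ lincomb cs bs

InSpan : ∀ {n d} → F2Vec n → Vec (F2Vec n) d → Set
InSpan v bs = Σ (Vec Bool _) λ cs → lincomb cs bs ≡ v

LinIndep : ∀ {n d} → Vec (F2Vec n) d → Set
LinIndep {d = d} bs = ∀ (cs : Vec Bool d) → lincomb cs bs ≡ 0ᵥ → cs ≡ replicate d false

countDim : ∀ {m} → (Fin m → ℕ) → ℕ → ℕ
countDim {zero} f d = 0
countDim {suc m} f d with f zero ≟ d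
... | yes _ = suc (countDim (λ i → f (suc i)) d)
... | no _ = countDim (λ i → f (suc i)) d

-- A vector space partition of F₂ⁿ: a finite family of nonzero subspaces,
-- the i-th of dimension dim i, given by a basis (linearly independent,
-- the subspace is its span), such that every nonzero vector lies in
-- exactly one member.
record VectorSpacePartition (n : ℕ) : Set where
  field
    m       : ℕ
    dim     : Fin m → ℕ
    basis   : (i : Fin m) → Vec (F2Vec n) (dim i)
    indep   : ∀ i → LinIndep (basis i)
    nonzero : ∀ i → 1 ≤ dim i
    cover   : ∀ (v : F2Vec n) → v ≢ 0ᵥ →
              Σ (Fin m) λ i → InSpan v (basis i) ×
                (∀ j → InSpan v (basis j) → j ≡ i)

-- Type given as a list of (dimension, multiplicity) pairs: the partition
-- has exactly the stated multiplicities, and no members of other dimensions.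
HasType : ∀ {n} → VectorSpacePartition n → List (ℕ × ℕ) → Set
HasType P τ =
  (∀ i → Any (λ p → dim i ≡ proj₁ p) τ) ×
  All (λ p → countDim dim (proj₁ p) ≡ proj₂ p) τ
  where open VectorSpacePartition P

module Submission where

-- Let e = k - 2 and let T be the list of generators of the 1-dimensional
-- members (the points).  For a ∈ F₂ᴺ, the number of v with a·v = 1 is 0 or 2ᴺ⁻¹,
-- and likewise 0 or 2ᵈ⁻¹ inside a member of dimension d; members of dimension
-- ≥ e + 1 therefore contribute multiples of 2ᵉ to this count, and splitting it along
-- the partition shows that the weight #{p ∈ T : a·p = 1} is divisible by 2ᵉ
-- (T is a 2ᵉ-divisible set).  But a 2ᵉ-divisible set of 2·2ᵉ + 1 distinct nonzero
-- points cannot exist for e ≥ 2: its weights must be 0 or 2ᵉ, and then the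
-- standard first and second moment identities Σₐ wt(a) = |T|·2ᴺ⁻¹ and
-- Σₐ wt(a)² = (|T|² + |T|)·2ᴺ⁻² are incompatible with |T| = 2ᵉ⁺¹ + 1.

open import Defs
open import Data.Bool using (Bool; true; false; _xor_; _∧_; not) renaming (_≟_ to _≟ᵇ_)
open import Data.Bool.Properties using (xor-identityʳ; xor-same; ∧-zeroʳ; ∧-comm; ∧-distribʳ-xor; xor-∧-commutativeRing)
open import Data.Nat using (ℕ; zero; suc; _+_; _*_; _∸_; _^_; _≥_; _≤_; _<_; z≤n; s≤s)
open import Data.Nat.Properties hiding (suc-injective)
open import Data.Nat.Divisibility using (_∣_; divides; _∣0; ∣m+n∣m⇒∣n; ∣m∣n⇒∣m+n; n∣m*n; ∣⇒≤)
open import Data.Nat.Tactic.RingSolver using (solve-∀)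
open import Data.Fin using (Fin; zero; suc)
open import Data.Fin.Properties using (suc-injective)
open import Data.Vec using (Vec; []; _∷_; replicate)
import Data.Vec as Vec
open import Data.Vec.Properties using (≡-dec)
open import Data.List using (List; []; _∷_; _++_; length)
import Data.List as List
open import Data.List.Properties using (length-++)
open import Data.List.Membership.Propositional using (_∈_)
open import Data.List.Membership.Propositional.Properties using (∈-++⁻)
open import Data.List.Relation.Unary.Any using (here; there)
open import Data.List.Relation.Unary.All using (All; []; _∷_)
import Data.List.Relation.Unary.All as All
open import Data.List.Relation.Unary.Unique.Propositional using (Unique)
import Data.List.Relation.Unary.Unique.Propositional.Properties as Unique
import Data.List.Relation.Unary.AllPairs as AllPairs
open import Data.Product using (Σ; _×_; _,_; proj₁; proj₂)
open import Data.Sum using (_⊎_; inj₁; inj₂)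
open import Data.Empty using (⊥; ⊥-elim)
open import Relation.Nullary using (¬_; yes; no; Dec)
open import Relation.Binary.PropositionalEquality
open import Function using (_∘_)
open import Algebra.Bundles using (CommutativeRing)
import Algebra.Properties.CommutativeSemigroup as CommSemigroupProperties

open CommSemigroupProperties +-commutativeSemigroup using () renaming (interchange to +-interchange)
open CommSemigroupProperties (CommutativeRing.+-commutativeSemigroup xor-∧-commutativeRing)
  using () renaming (interchange to xor-interchange)

∑ : ∀ {A : Set} → List A → (A → ℕ) → ℕ
∑ [] f = 0
∑ (x ∷ xs) f = f x + ∑ xs f

module _ {A : Set} where

  ∑-cong : ∀ (xs : List A) {f g} → (∀ x → f x ≡ g x) → ∑ xs f ≡ ∑ xs g
  ∑-cong [] f≗g = refl
  ∑-cong (x ∷ xs) f≗g = cong₂ _+_ (f≗g x) (∑-cong xs f≗g)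

  ∑-++ : ∀ (xs ys : List A) f → ∑ (xs ++ ys) f ≡ ∑ xs f + ∑ ys f
  ∑-++ [] ys f = refl
  ∑-++ (x ∷ xs) ys f = trans (cong (f x +_) (∑-++ xs ys f)) (sym (+-assoc (f x) _ _))

  ∑-+ : ∀ (xs : List A) f g → ∑ xs (λ x → f x + g x) ≡ ∑ xs f + ∑ xs g
  ∑-+ [] f g = refl
  ∑-+ (x ∷ xs) f g =
    trans (cong (f x + g x +_) (∑-+ xs f g)) (+-interchange (f x) (g x) (∑ xs f) (∑ xs g))

  ∑-*ˡ : ∀ (xs : List A) c f → ∑ xs (λ x → c * f x) ≡ c * ∑ xs f
  ∑-*ˡ [] c f = sym (*-zeroʳ c)
  ∑-*ˡ (x ∷ xs) c f = trans (cong (c * f x +_) (∑-*ˡ xs c f)) (sym (*-distribˡ-+ c (f x) _))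

  ∑-*ʳ : ∀ (xs : List A) f c → ∑ xs f * c ≡ ∑ xs (λ x → f x * c)
  ∑-*ʳ [] f c = refl
  ∑-*ʳ (x ∷ xs) f c = trans (*-distribʳ-+ c (f x) _) (cong (f x * c +_) (∑-*ʳ xs f c))

  ∑-zero : ∀ (xs : List A) {f} → (∀ x → f x ≡ 0) → ∑ xs f ≡ 0
  ∑-zero [] f≗0 = refl
  ∑-zero (x ∷ xs) f≗0 = cong₂ _+_ (f≗0 x) (∑-zero xs f≗0)

  ∑-const : ∀ (xs : List A) {f} c → All (λ x → f x ≡ c) xs → ∑ xs f ≡ length xs * c
  ∑-const [] c [] = refl
  ∑-const (x ∷ xs) c (fx≡c ∷ rest) = cong₂ _+_ fx≡c (∑-const xs c rest)

  ∑-mono-≤ : ∀ (xs : List A) {f g} → (∀ x → f x ≤ g x) → ∑ xs f ≤ ∑ xs g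
  ∑-mono-≤ [] f≤g = z≤n
  ∑-mono-≤ (x ∷ xs) f≤g = +-mono-≤ (f≤g x) (∑-mono-≤ xs f≤g)

  term≤∑ : ∀ {xs : List A} {x} f → x ∈ xs → f x ≤ ∑ xs f
  term≤∑ f (here refl) = m≤m+n _ _
  term≤∑ {y ∷ xs} f (there x∈xs) = ≤-trans (term≤∑ f x∈xs) (m≤n+m _ (f y))

  ∑-positive : ∀ (xs : List A) f → 0 < ∑ xs f → Σ A λ x → x ∈ xs × 0 < f x
  ∑-positive [] f ()
  ∑-positive (x ∷ xs) f pos with f x in fx≡
  ... | suc _ = x , here refl , subst (0 <_) (sym fx≡) (s≤s z≤n)
  ... | zero with ∑-positive xs f pos
  ...   | y , y∈xs , fy>0 = y , there y∈xs , fy>0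

module _ {A B : Set} where

  ∑-map : ∀ (g : A → B) (xs : List A) f → ∑ (List.map g xs) f ≡ ∑ xs (f ∘ g)
  ∑-map g [] f = refl
  ∑-map g (x ∷ xs) f = cong (f (g x) +_) (∑-map g xs f)

  ∑-swap : ∀ (xs : List A) (ys : List B) (f : A → B → ℕ) →
    ∑ xs (λ x → ∑ ys (f x)) ≡ ∑ ys (λ y → ∑ xs (λ x → f x y))
  ∑-swap [] ys f = sym (∑-zero ys (λ _ → refl))
  ∑-swap (x ∷ xs) ys f =
    trans (cong (∑ ys (f x) +_) (∑-swap xs ys f)) (sym (∑-+ ys (f x) (λ y → ∑ xs (λ x' → f x' y))))

∑ᶠ : ∀ m → (Fin m → ℕ) → ℕ
∑ᶠ zero h = 0
∑ᶠ (suc m) h = h zero + ∑ᶠ m (h ∘ suc)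

∑ᶠ-cong : ∀ m {h g} → (∀ i → h i ≡ g i) → ∑ᶠ m h ≡ ∑ᶠ m g
∑ᶠ-cong zero h≗g = refl
∑ᶠ-cong (suc m) h≗g = cong₂ _+_ (h≗g zero) (∑ᶠ-cong m (h≗g ∘ suc))

∑ᶠ-∑-swap : ∀ {A : Set} m (xs : List A) (h : Fin m → A → ℕ) →
  ∑ᶠ m (λ i → ∑ xs (h i)) ≡ ∑ xs (λ x → ∑ᶠ m (λ i → h i x))
∑ᶠ-∑-swap zero xs h = sym (∑-zero xs (λ _ → refl))
∑ᶠ-∑-swap (suc m) xs h = trans (cong (∑ xs (h zero) +_) (∑ᶠ-∑-swap m xs (h ∘ suc))) (sym (∑-+ xs _ _))

∑ᶠ-*ʳ : ∀ m (h : Fin m → ℕ) c → ∑ᶠ m h * c ≡ ∑ᶠ m (λ i → h i * c)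
∑ᶠ-*ʳ zero h c = refl
∑ᶠ-*ʳ (suc m) h c = trans (*-distribʳ-+ c (h zero) _) (cong (h zero * c +_) (∑ᶠ-*ʳ m (h ∘ suc) c))

∑ᶠ-single : ∀ m (h : Fin m → ℕ) i → (∀ j → j ≢ i → h j ≡ 0) → ∑ᶠ m h ≡ h i
∑ᶠ-single (suc m) h zero vanish =
  trans (cong (h zero +_) (∑ᶠ-zero m (λ j → vanish (suc j) (λ ())))) (+-identityʳ _)
  where
  ∑ᶠ-zero : ∀ m {g : Fin m → ℕ} → (∀ j → g j ≡ 0) → ∑ᶠ m g ≡ 0
  ∑ᶠ-zero zero g≗0 = refl
  ∑ᶠ-zero (suc m) g≗0 = cong₂ _+_ (g≗0 zero) (∑ᶠ-zero m (g≗0 ∘ suc))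
∑ᶠ-single (suc m) h (suc i) vanish =
  trans (cong (_+ ∑ᶠ m (h ∘ suc)) (vanish zero (λ ())))
        (∑ᶠ-single m (h ∘ suc) i (λ j j≢i → vanish (suc j) (j≢i ∘ suc-injective)))

bit : Bool → ℕ
bit true = 1
bit false = 0

bit≤1 : ∀ x → bit x ≤ 1
bit≤1 false = z≤n
bit≤1 true = s≤s z≤n

bit+bit-not : ∀ x → bit x + bit (not x) ≡ 1
bit+bit-not true = refl
bit+bit-not false = refl

bit-positive : ∀ x → 0 < bit x → x ≡ true
bit-positive true _ = refl

_≟ᵥ_ : ∀ {n} (u v : F2Vec n) → Dec (u ≡ v)
_≟ᵥ_ = ≡-dec _≟ᵇ_

∧-xor-interchange : ∀ x y z a b →
  ((x xor y) ∧ z) xor (a xor b) ≡ ((x ∧ z) xor a) xor ((y ∧ z) xor b)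
∧-xor-interchange x y z a b =
  trans (cong (_xor (a xor b)) (∧-distribʳ-xor z x y)) (xor-interchange (x ∧ z) (y ∧ z) a b)

+ᵥ-self : ∀ {n} (u : F2Vec n) → u +ᵥ u ≡ 0ᵥ
+ᵥ-self [] = refl
+ᵥ-self (x ∷ u) = cong₂ _∷_ (xor-same x) (+ᵥ-self u)

+ᵥ≡0⇒≡ : ∀ {n} (u v : F2Vec n) → u +ᵥ v ≡ 0ᵥ → u ≡ v
+ᵥ≡0⇒≡ [] [] _ = refl
+ᵥ≡0⇒≡ (x ∷ u) (y ∷ v) sum≡0 =
  cong₂ _∷_ (xor≡false x y (cong Vec.head sum≡0)) (+ᵥ≡0⇒≡ u v (cong Vec.tail sum≡0))
  where
  xor≡false : ∀ x y → x xor y ≡ false → x ≡ y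
  xor≡false false false _ = refl
  xor≡false true true _ = refl

·ᵥ-+ᵥ-interchange : ∀ {n} x y (u v w : F2Vec n) →
  ((x xor y) ·ᵥ u) +ᵥ (v +ᵥ w) ≡ ((x ·ᵥ u) +ᵥ v) +ᵥ ((y ·ᵥ u) +ᵥ w)
·ᵥ-+ᵥ-interchange x y [] [] [] = refl
·ᵥ-+ᵥ-interchange x y (z ∷ u) (a ∷ v) (b ∷ w) =
  cong₂ _∷_ (∧-xor-interchange x y z a b) (·ᵥ-+ᵥ-interchange x y u v w)

lincomb-+ : ∀ {n d} (c c' : Vec Bool d) (bs : Vec (F2Vec n) d) →
  lincomb (c +ᵥ c') bs ≡ lincomb c bs +ᵥ lincomb c' bs
lincomb-+ [] [] [] = sym (+ᵥ-self 0ᵥ)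
lincomb-+ (x ∷ c) (y ∷ c') (u ∷ bs) =
  trans (cong (((x xor y) ·ᵥ u) +ᵥ_) (lincomb-+ c c' bs)) (·ᵥ-+ᵥ-interchange x y u _ _)

lincomb-injective : ∀ {n d} (bs : Vec (F2Vec n) d) → LinIndep bs →
  ∀ c c' → lincomb c bs ≡ lincomb c' bs → c ≡ c'
lincomb-injective bs indep c c' same =
  +ᵥ≡0⇒≡ c c' (indep (c +ᵥ c') (trans (lincomb-+ c c' bs) (trans (cong (_+ᵥ lincomb c' bs) same) (+ᵥ-self _))))

dot : ∀ {n} → F2Vec n → F2Vec n → Bool
dot [] [] = false
dot (x ∷ u) (y ∷ v) = (x ∧ y) xor dot u v

dot-zeroʳ : ∀ {n} (u : F2Vec n) → dot u 0ᵥ ≡ false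
dot-zeroʳ [] = refl
dot-zeroʳ (x ∷ u) = cong₂ _xor_ (∧-zeroʳ x) (dot-zeroʳ u)

dot-comm : ∀ {n} (u v : F2Vec n) → dot u v ≡ dot v u
dot-comm [] [] = refl
dot-comm (x ∷ u) (y ∷ v) = cong₂ _xor_ (∧-comm x y) (dot-comm u v)

dot-+ˡ : ∀ {n} (u v w : F2Vec n) → dot (u +ᵥ v) w ≡ dot u w xor dot v w
dot-+ˡ [] [] [] = refl
dot-+ˡ (x ∷ u) (y ∷ v) (z ∷ w) =
  trans (cong (((x xor y) ∧ z) xor_) (dot-+ˡ u v w)) (∧-xor-interchange x y z (dot u w) (dot v w))

dot-+ʳ : ∀ {n} (u v w : F2Vec n) → dot u (v +ᵥ w) ≡ dot u v xor dot u w
dot-+ʳ u v w = trans (dot-comm u (v +ᵥ w)) (trans (dot-+ˡ v w u) (cong₂ _xor_ (dot-comm v u) (dot-comm w u)))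

dot-·ᵥʳ : ∀ {n} (u : F2Vec n) x v → dot u (x ·ᵥ v) ≡ x ∧ dot u v
dot-·ᵥʳ [] x [] = sym (∧-zeroʳ x)
dot-·ᵥʳ (y ∷ u) false (z ∷ v) = trans (cong (_xor dot u (false ·ᵥ v)) (∧-zeroʳ y)) (dot-·ᵥʳ u false v)
dot-·ᵥʳ (y ∷ u) true (z ∷ v) = cong ((y ∧ z) xor_) (dot-·ᵥʳ u true v)

dot-lincomb : ∀ {n d} (u : F2Vec n) (c : Vec Bool d) bs → dot u (lincomb c bs) ≡ dot c (Vec.map (dot u) bs)
dot-lincomb u [] [] = dot-zeroʳ u
dot-lincomb u (x ∷ c) (v ∷ bs) =
  trans (dot-+ʳ u (x ·ᵥ v) (lincomb c bs)) (cong₂ _xor_ (dot-·ᵥʳ u x v) (dot-lincomb u c bs))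

-- Counting in F₂ⁿ: orthogonality relations for the bilinear form.

allVecs : (n : ℕ) → List (F2Vec n)
allVecs zero = [] ∷ []
allVecs (suc n) = List.map (false ∷_) (allVecs n) ++ List.map (true ∷_) (allVecs n)

∑-allVecs-suc : ∀ n f →
  ∑ (allVecs (suc n)) f ≡ ∑ (allVecs n) (λ a → f (false ∷ a)) + ∑ (allVecs n) (λ a → f (true ∷ a))
∑-allVecs-suc n f =
  trans (∑-++ (List.map (false ∷_) (allVecs n)) _ f) (cong₂ _+_ (∑-map _ (allVecs n) f) (∑-map _ (allVecs n) f))

∣F2Vec∣ : ∀ n → ∑ (allVecs n) (λ _ → 1) ≡ 2 ^ n
∣F2Vec∣ zero = refl
∣F2Vec∣ (suc n) =
  trans (∑-allVecs-suc n (λ _ → 1)) (trans (cong₂ _+_ (∣F2Vec∣ n) (∣F2Vec∣ n)) (cong (2 ^ n +_) (sym (+-identityʳ (2 ^ n)))))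

2^n≢0 : ∀ n → 2 ^ n ≢ 0
2^n≢0 n 2^n≡0 = <⇒≢ (m^n>0 2 n) (sym 2^n≡0)

oddCount : ∀ {n} → F2Vec n → ℕ
oddCount {n} p = ∑ (allVecs n) (λ a → bit (dot a p))

-- Induct on the first coordinate x of p; when the tail of p is zero, x = 1 and the
-- count is the number of vectors with first coordinate 1.
dot-balanced : ∀ n (p : F2Vec n) → p ≢ 0ᵥ → 2 * oddCount p ≡ 2 ^ n
dot-balanced zero [] p≢0 = ⊥-elim (p≢0 refl)
dot-balanced (suc n) (x ∷ p) p≢0 =
  trans (cong (2 *_) (∑-allVecs-suc n (λ a → bit (dot a (x ∷ p))))) (byHead x (p ≟ᵥ 0ᵥ) p≢0)
  where
  byHead : ∀ x → Dec (p ≡ 0ᵥ) → x ∷ p ≢ 0ᵥ →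
    2 * (oddCount p + ∑ (allVecs n) (λ a → bit (x xor dot a p))) ≡ 2 ^ suc n
  byHead false (yes refl) x∷p≢0 = ⊥-elim (x∷p≢0 refl)
  byHead true (yes refl) _ =
    cong (2 *_) (cong₂ _+_ (∑-zero (allVecs n) (λ a → cong bit (dot-zeroʳ a)))
                           (trans (∑-cong (allVecs n) (λ a → cong (λ b → bit (not b)) (dot-zeroʳ a))) (∣F2Vec∣ n)))
  byHead false (no p≢0) _ =
    trans (*-distribˡ-+ 2 (∑ (allVecs n) _) _)
          (trans (cong₂ _+_ (dot-balanced n p p≢0) (dot-balanced n p p≢0)) (cong (2 ^ n +_) (sym (+-identityʳ (2 ^ n)))))
  byHead true (no _) _ =
    cong (2 *_) (trans (sym (∑-+ (allVecs n) _ _)) (trans (∑-cong (allVecs n) (λ a → bit+bit-not (dot a p))) (∣F2Vec∣ n)))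

odd-partner : ∀ n (p : F2Vec n) → p ≢ 0ᵥ → Σ (F2Vec n) λ b → dot b p ≡ true
odd-partner n p p≢0 = let (b , _ , b·p>0) = ∑-positive (allVecs n) _ (half-positive (dot-balanced n p p≢0)) in
  b , bit-positive _ b·p>0
  where
  half-positive : ∀ {s} → 2 * s ≡ 2 ^ n → 0 < s
  half-positive {zero} 0≡2^n = ⊥-elim (2^n≢0 n (sym 0≡2^n))
  half-positive {suc s} _ = s≤s z≤n

oddCount-dichotomy : ∀ n (p : F2Vec n) → oddCount p ≡ 0 ⊎ 2 * oddCount p ≡ 2 ^ n
oddCount-dichotomy n p with p ≟ᵥ 0ᵥ
... | yes refl = inj₁ (∑-zero (allVecs n) (λ a → cong bit (dot-zeroʳ a)))
... | no p≢0 = inj₂ (dot-balanced n p p≢0)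

2^-mono-∣ : ∀ {e n} → e ≤ n → 2 ^ e ∣ 2 ^ n
2^-mono-∣ {e} {n} e≤n = divides (2 ^ (n ∸ e)) (trans (cong (2 ^_) (sym (m∸n+n≡m e≤n))) (^-distribˡ-+-* 2 (n ∸ e) e))

oddCount-divisible : ∀ {e n} (p : F2Vec n) → e < n → 2 ^ e ∣ oddCount p
oddCount-divisible {e} {suc n} p (s≤s e≤n) with oddCount-dichotomy (suc n) p
... | inj₁ none = subst (2 ^ e ∣_) (sym none) ((2 ^ e) ∣0)
... | inj₂ half = subst (2 ^ e ∣_) (sym (*-cancelˡ-≡ _ _ 2 half)) (2^-mono-∣ e≤n)

jointCount : ∀ {n} → F2Vec n → F2Vec n → ℕ
jointCount {n} p q = ∑ (allVecs n) (λ a → bit (dot a p) * bit (dot a q))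

-- Pairwise orthogonality: distinct nonzero p, q are jointly 1 on a quarter of F₂ⁿ.
-- Inclusion–exclusion 2·[x ∧ y] + [x ⊕ y] = [x] + [y], summed, with p + q ≠ 0.
jointCount-distinct : ∀ n (p q : F2Vec n) → p ≢ 0ᵥ → q ≢ 0ᵥ → p ≢ q → 4 * jointCount p q ≡ 2 ^ n
jointCount-distinct n p q p≢0 q≢0 p≢q =
  +-cancelʳ-≡ _ _ (2 ^ n) (trans quadrupled (cong₂ _+_ (dot-balanced n p p≢0) (dot-balanced n q q≢0)))
  where
  V = allVecs n
  inclusion-exclusion : ∀ x y → 2 * (bit x * bit y) + bit (x xor y) ≡ bit x + bit y
  inclusion-exclusion false false = refl
  inclusion-exclusion false true = refl
  inclusion-exclusion true false = refl
  inclusion-exclusion true true = refl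
  summed : 2 * jointCount p q + oddCount (p +ᵥ q) ≡ oddCount p + oddCount q
  summed = begin
    2 * jointCount p q + oddCount (p +ᵥ q)
      ≡⟨ cong₂ _+_ (sym (∑-*ˡ V 2 _)) (∑-cong V (λ a → cong bit (dot-+ʳ a p q))) ⟩
    ∑ V (λ a → 2 * (bit (dot a p) * bit (dot a q))) + ∑ V (λ a → bit (dot a p xor dot a q))
      ≡⟨ sym (∑-+ V _ _) ⟩
    ∑ V (λ a → 2 * (bit (dot a p) * bit (dot a q)) + bit (dot a p xor dot a q))
      ≡⟨ ∑-cong V (λ a → inclusion-exclusion (dot a p) (dot a q)) ⟩
    ∑ V (λ a → bit (dot a p) + bit (dot a q))
      ≡⟨ ∑-+ V _ _ ⟩
    oddCount p + oddCount q ∎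
    where open ≡-Reasoning
  quadrupled : 4 * jointCount p q + 2 ^ n ≡ 2 * oddCount p + 2 * oddCount q
  quadrupled = begin
    4 * jointCount p q + 2 ^ n
      ≡⟨ cong₂ _+_ (*-assoc 2 2 (jointCount p q)) (sym (dot-balanced n (p +ᵥ q) (p≢q ∘ +ᵥ≡0⇒≡ p q))) ⟩
    2 * (2 * jointCount p q) + 2 * oddCount (p +ᵥ q)
      ≡⟨ sym (*-distribˡ-+ 2 (2 * jointCount p q) _) ⟩
    2 * (2 * jointCount p q + oddCount (p +ᵥ q))
      ≡⟨ cong (2 *_) summed ⟩
    2 * (oddCount p + oddCount q)
      ≡⟨ *-distribˡ-+ 2 (oddCount p) (oddCount q) ⟩
    2 * oddCount p + 2 * oddCount q ∎
    where open ≡-Reasoning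

jointCount-diagonal : ∀ n (p : F2Vec n) → p ≢ 0ᵥ → 4 * jointCount p p ≡ 2 * 2 ^ n
jointCount-diagonal n p p≢0 =
  trans (*-assoc 2 2 (jointCount p p))
        (cong (2 *_) (trans (cong (2 *_) (∑-cong (allVecs n) (λ a → bit-square (dot a p)))) (dot-balanced n p p≢0)))
  where
  bit-square : ∀ x → bit x * bit x ≡ bit x
  bit-square false = refl
  bit-square true = refl

δ : ∀ {n} → F2Vec n → F2Vec n → ℕ
δ u v with u ≟ᵥ v
... | yes _ = 1
... | no _ = 0

δ-refl : ∀ {n} (u : F2Vec n) → δ u u ≡ 1
δ-refl u with u ≟ᵥ u
... | yes _ = refl
... | no u≢u = ⊥-elim (u≢u refl)

δ-distinct : ∀ {n} (u v : F2Vec n) → u ≢ v → δ u v ≡ 0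
δ-distinct u v u≢v with u ≟ᵥ v
... | yes u≡v = ⊥-elim (u≢v u≡v)
... | no _ = refl

δ-∷ : ∀ {n} x (a u : F2Vec n) → δ (x ∷ a) (x ∷ u) ≡ δ a u
δ-∷ x a u = byTail (a ≟ᵥ u)
  where
  byTail : Dec (a ≡ u) → δ (x ∷ a) (x ∷ u) ≡ δ a u
  byTail (yes refl) = trans (δ-refl (x ∷ a)) (sym (δ-refl a))
  byTail (no a≢u) = trans (δ-distinct (x ∷ a) (x ∷ u) (a≢u ∘ cong Vec.tail)) (sym (δ-distinct a u a≢u))

δ-sift : ∀ n (u : F2Vec n) (g : F2Vec n → ℕ) → ∑ (allVecs n) (λ v → δ v u * g v) ≡ g u
δ-sift zero [] g = trans (cong (λ d → d * g [] + 0) (δ-refl [])) (trans (+-identityʳ _) (+-identityʳ _))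
δ-sift (suc n) (x ∷ u) g = trans (∑-allVecs-suc n _) (byHead x)
  where
  V = allVecs n
  sameHead : ∀ x → ∑ V (λ a → δ (x ∷ a) (x ∷ u) * g (x ∷ a)) ≡ g (x ∷ u)
  sameHead x = trans (∑-cong V (λ a → cong (_* g (x ∷ a)) (δ-∷ x a u))) (δ-sift n u (λ a → g (x ∷ a)))
  otherHead : ∀ x y → x ≢ y → ∑ V (λ a → δ (y ∷ a) (x ∷ u) * g (y ∷ a)) ≡ 0
  otherHead x y x≢y = ∑-zero V (λ a → cong (_* g (y ∷ a)) (δ-distinct (y ∷ a) (x ∷ u) (x≢y ∘ sym ∘ cong Vec.head)))
  byHead : ∀ x → ∑ V (λ a → δ (false ∷ a) (x ∷ u) * g (false ∷ a)) + ∑ V (λ a → δ (true ∷ a) (x ∷ u) * g (true ∷ a))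
               ≡ g (x ∷ u)
  byHead false = trans (cong₂ _+_ (sameHead false) (otherHead false true (λ ()))) (+-identityʳ _)
  byHead true = cong₂ _+_ (otherHead true false (λ ())) (sameHead true)

-- Divisible sets of points.

-- weight T a counts the p ∈ T with a·p = 1 (the weight of the codeword of a in the
-- code whose generator matrix has columns T).
weight : ∀ {n} → List (F2Vec n) → F2Vec n → ℕ
weight T a = ∑ T (λ p → bit (dot a p))

coweight : ∀ {n} → List (F2Vec n) → F2Vec n → ℕ
coweight T a = ∑ T (λ p → bit (not (dot a p)))

weight+coweight : ∀ {n} (T : List (F2Vec n)) a → weight T a + coweight T a ≡ length T
weight+coweight T a =
  trans (sym (∑-+ T _ _)) (trans (∑-cong T (λ p → bit+bit-not (dot a p)))
        (trans (∑-const T 1 (All.universal (λ _ → refl) T)) (*-identityʳ _)))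

weight≤length : ∀ {n} (T : List (F2Vec n)) a → weight T a ≤ length T
weight≤length T a = subst (weight T a ≤_) (weight+coweight T a) (m≤m+n _ _)

separating : ∀ {n} → List (F2Vec n) → F2Vec n → F2Vec n → ℕ
separating T a b = ∑ T (λ q → bit (not (dot a q) ∧ dot b q))

-- Pointwise, [b·q] + [(a+b)·q] = 2·[a·q = 0 ∧ b·q = 1] + [a·q].
weight-translate : ∀ {n} (T : List (F2Vec n)) a b →
  weight T b + weight T (a +ᵥ b) ≡ 2 * separating T a b + weight T a
weight-translate T a b =
  trans (sym (∑-+ T _ _))
        (trans (∑-cong T (λ q → trans (cong (λ z → bit (dot b q) + bit z) (dot-+ˡ a b q)) (pointwise (dot a q) (dot b q))))
               (trans (∑-+ T _ _) (cong (_+ weight T a) (∑-*ˡ T 2 _))))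
  where
  pointwise : ∀ x y → bit y + bit (x xor y) ≡ 2 * bit (not x ∧ y) + bit x
  pointwise false false = refl
  pointwise false true = refl
  pointwise true false = refl
  pointwise true true = refl

separating-single : ∀ {n} (T : List (F2Vec n)) a b {p} → coweight T a ≡ 1 → p ∈ T →
  not (dot a p) ≡ true → dot b p ≡ true → separating T a b ≡ 1
separating-single T a b coweight≡1 p∈T a⊥p b·p≡1 =
  ≤-antisym (subst (separating T a b ≤_) coweight≡1 (∑-mono-≤ T (λ q → ∧-≤ (not (dot a q)) (dot b q))))
            (subst (_≤ separating T a b) (cong₂ (λ u v → bit (u ∧ v)) a⊥p b·p≡1)
                   (term≤∑ (λ q → bit (not (dot a q) ∧ dot b q)) p∈T))
  where
  ∧-≤ : ∀ x y → bit (x ∧ y) ≤ bit x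
  ∧-≤ false y = z≤n
  ∧-≤ true y = bit≤1 y

weight-first-moment : ∀ n (T : List (F2Vec n)) → All (_≢ 0ᵥ) T →
  2 * ∑ (allVecs n) (weight T) ≡ length T * 2 ^ n
weight-first-moment n T nonzero =
  trans (cong (2 *_) (∑-swap (allVecs n) T _))
        (trans (sym (∑-*ˡ T 2 _)) (∑-const T _ (All.map (dot-balanced n _) nonzero)))

-- Summing jointCount over all pairs of a set of distinct nonzero points: the |T|
-- diagonal terms contribute 2·2ⁿ each, the |T|² - |T| others 2ⁿ each (all scaled by 4).
jointCount-total : ∀ n (T : List (F2Vec n)) → All (_≢ 0ᵥ) T → Unique T →
  ∑ T (λ p → ∑ T (λ q → 4 * jointCount p q)) ≡ (length T * length T + length T) * 2 ^ n
jointCount-total n [] [] AllPairs.[] = refl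
jointCount-total n (p ∷ T) (p≢0 ∷ nonzero) (p∉T AllPairs.∷ unique) =
  trans (cong₂ _+_ (cong₂ _+_ (jointCount-diagonal n p p≢0) (∑-const T _ row))
                   (trans (∑-+ T _ _) (cong₂ _+_ (∑-const T _ column) (jointCount-total n T nonzero unique))))
        (count (length T) (2 ^ n))
  where
  row : All (λ q → 4 * jointCount p q ≡ 2 ^ n) T
  row = All.zipWith (λ (q≢0 , p≢q) → jointCount-distinct n p _ p≢0 q≢0 p≢q) (nonzero , p∉T)
  column : All (λ q → 4 * jointCount q p ≡ 2 ^ n) T
  column = All.zipWith (λ (q≢0 , p≢q) → jointCount-distinct n _ p q≢0 p≢0 (p≢q ∘ sym)) (nonzero , p∉T)
  count : ∀ m X → 2 * X + m * X + (m * X + (m * m + m) * X) ≡ (suc m * suc m + suc m) * X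
  count = solve-∀

weight-square-expand : ∀ {n} (T : List (F2Vec n)) a →
  weight T a * weight T a ≡ ∑ T (λ p → ∑ T (λ q → bit (dot a p) * bit (dot a q)))
weight-square-expand T a =
  trans (∑-*ʳ T _ (weight T a)) (∑-cong T (λ p → sym (∑-*ˡ T (bit (dot a p)) (λ q → bit (dot a q)))))

weight-second-moment : ∀ n (T : List (F2Vec n)) → All (_≢ 0ᵥ) T → Unique T →
  4 * ∑ (allVecs n) (λ a → weight T a * weight T a) ≡ (length T * length T + length T) * 2 ^ n
weight-second-moment n T nonzero unique = begin
  4 * ∑ V (λ a → weight T a * weight T a)
    ≡⟨ cong (4 *_) (∑-cong V (weight-square-expand T)) ⟩
  4 * ∑ V (λ a → ∑ T (λ p → ∑ T (λ q → bit (dot a p) * bit (dot a q))))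
    ≡⟨ cong (4 *_) (trans (∑-swap V T _) (∑-cong T (λ p → ∑-swap V T _))) ⟩
  4 * ∑ T (λ p → ∑ T (λ q → jointCount p q))
    ≡⟨ trans (sym (∑-*ˡ T 4 _)) (∑-cong T (λ p → sym (∑-*ˡ T 4 _))) ⟩
  ∑ T (λ p → ∑ T (λ q → 4 * jointCount p q))
    ≡⟨ jointCount-total n T nonzero unique ⟩
  (length T * length T + length T) * 2 ^ n ∎
  where
  open ≡-Reasoning
  V = allVecs n

-- Weights then lie in {0, w}
-- (2w is excluded by a parity argument), so weight² = w · weight; comparing the
-- first and second moments gives 2w = |T| + 1 = 2w + 2.
module NoDivisibleSet (n w : ℕ) (T : List (F2Vec n)) (w>2 : 2 < w) (∣T∣≡ : length T ≡ 1 + 2 * w)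
                      (nonzero : All (_≢ 0ᵥ) T) (unique : Unique T) (divisible : ∀ a → w ∣ weight T a) where

  -- If a pairs to 0 with only one point p of T, choose b with b·p = 1; then
  -- weight b + weight (a + b) = 2 + 2w, so w ∣ 2, contradicting w > 2.
  weight≢2w : ∀ a → weight T a ≢ 2 * w
  weight≢2w a weight≡2w = <⇒≱ w>2 (∣⇒≤ w∣2)
    where
    coweight≡1 : coweight T a ≡ 1
    coweight≡1 = +-cancelˡ-≡ (2 * w) _ _ (begin
      2 * w + coweight T a      ≡⟨ cong (_+ coweight T a) (sym weight≡2w) ⟩
      weight T a + coweight T a ≡⟨ weight+coweight T a ⟩
      length T                  ≡⟨ trans ∣T∣≡ (+-comm 1 (2 * w)) ⟩
      2 * w + 1                 ∎)
      where open ≡-Reasoning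
    orthogonal = ∑-positive T (λ p → bit (not (dot a p))) (subst (0 <_) (sym coweight≡1) (s≤s z≤n))
    p = proj₁ orthogonal
    p∈T : p ∈ T
    p∈T = proj₁ (proj₂ orthogonal)
    partner = odd-partner n p (All.lookup nonzero p∈T)
    b = proj₁ partner
    weights : weight T b + weight T (a +ᵥ b) ≡ 2 * w + 2
    weights = trans (weight-translate T a b)
                    (trans (cong₂ _+_ (cong (2 *_) (separating-single T a b coweight≡1 p∈T (bit-positive _ (proj₂ (proj₂ orthogonal))) (proj₂ partner)))
                                      weight≡2w)
                           (+-comm 2 (2 * w)))
    w∣2 : w ∣ 2
    w∣2 = ∣m+n∣m⇒∣n (subst (w ∣_) weights (∣m∣n⇒∣m+n (divisible b) (divisible (a +ᵥ b)))) (n∣m*n 2)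

  -- A weight is a multiple of w below 3w, and not 2w, so it is 0 or w.
  weight-square : ∀ a → weight T a * weight T a ≡ w * weight T a
  weight-square a with divisible a
  ... | divides zero weight≡ rewrite weight≡ = sym (*-zeroʳ w)
  ... | divides 1 weight≡ rewrite weight≡ = cong (_* (w + 0)) (+-identityʳ w)
  ... | divides 2 weight≡ = ⊥-elim (weight≢2w a (trans weight≡ (cong (λ z → w + (w + z)) (sym (+-identityʳ 0)))))
  ... | divides (suc (suc (suc q))) weight≡ = ⊥-elim (<⇒≱ w>2 (≤-trans (+-cancelˡ-≤ (2 * w) w 1 3w≤2w+1) (n≤1+n 1)))
    where
    expand : ∀ q w → suc (suc (suc q)) * w ≡ 2 * w + (w + q * w)
    expand = solve-∀
    3w≤2w+1 : 2 * w + w ≤ 2 * w + 1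
    3w≤2w+1 = begin
      2 * w + w             ≤⟨ +-monoʳ-≤ (2 * w) (m≤m+n w (q * w)) ⟩
      2 * w + (w + q * w)   ≡⟨ sym (expand q w) ⟩
      suc (suc (suc q)) * w ≡⟨ sym weight≡ ⟩
      weight T a            ≤⟨ weight≤length T a ⟩
      length T              ≡⟨ ∣T∣≡ ⟩
      1 + 2 * w             ≡⟨ +-comm 1 (2 * w) ⟩
      2 * w + 1             ∎
      where open ≤-Reasoning

  contradiction : ⊥
  contradiction = 2^n≢0 n (m*n≡0⇒m≡0 X (2 + 4 * w) (trans (*-comm X (2 + 4 * w)) (+-cancelˡ-≡ (2 * w * (m * X)) _ _ moments)))
    where
    V = allVecs n
    X = 2 ^ n
    m = 1 + 2 * w
    first : 2 * ∑ V (weight T) ≡ m * X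
    first = trans (weight-first-moment n T nonzero) (cong (_* X) ∣T∣≡)
    second : 4 * ∑ V (λ a → weight T a * weight T a) ≡ (m * m + m) * X
    second = trans (weight-second-moment n T nonzero unique) (cong (λ l → (l * l + l) * X) ∣T∣≡)
    moments : 2 * w * (m * X) + (2 + 4 * w) * X ≡ 2 * w * (m * X) + 0
    moments = begin
      2 * w * (m * X) + (2 + 4 * w) * X       ≡⟨ expand w X ⟩
      (m * m + m) * X                         ≡⟨ sym second ⟩
      4 * ∑ V (λ a → weight T a * weight T a) ≡⟨ cong (4 *_) (∑-cong V weight-square) ⟩
      4 * ∑ V (λ a → w * weight T a)          ≡⟨ cong (4 *_) (∑-*ˡ V w (weight T)) ⟩
      4 * (w * ∑ V (weight T))                ≡⟨ regroup w (∑ V (weight T)) ⟩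
      2 * w * (2 * ∑ V (weight T))            ≡⟨ cong (2 * w *_) first ⟩
      2 * w * (m * X)                         ≡⟨ sym (+-identityʳ _) ⟩
      2 * w * (m * X) + 0                     ∎
      where
      open ≡-Reasoning
      expand : ∀ w X → 2 * w * ((1 + 2 * w) * X) + (2 + 4 * w) * X ≡ ((1 + 2 * w) * (1 + 2 * w) + (1 + 2 * w)) * X
      expand = solve-∀
      regroup : ∀ w s → 4 * (w * s) ≡ 2 * w * (2 * s)
      regroup = solve-∀

-- Sums over F₂ᴺ split along a vector space partition.

spanSum : ∀ {N d} → Vec (F2Vec N) d → (F2Vec N → ℕ) → ℕ
spanSum {d = d} B f = ∑ (allVecs d) (λ c → f (lincomb c B))

module _ {N : ℕ} (P : VectorSpacePartition N) where
  open VectorSpacePartition P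

  members-meet-trivially : ∀ v i j → v ≢ 0ᵥ → InSpan v (basis i) → InSpan v (basis j) → i ≡ j
  members-meet-trivially v i j v≢0 v∈i v∈j = let (_ , _ , only) = cover v v≢0 in trans (only i v∈i) (sym (only j v∈j))

  -- Every nonzero vector is enumerated exactly once by the members of P: only its own
  -- member contains it, and there a unique coefficient vector produces it.
  multiplicity-one : ∀ v → v ≢ 0ᵥ → ∑ᶠ m (λ i → spanSum (basis i) (δ v)) ≡ 1
  multiplicity-one v v≢0 with cover v v≢0
  ... | i , (c₀ , c₀↦v) , only =
    trans (∑ᶠ-single m _ i (λ j j≢i → ∑-zero (allVecs (dim j)) (λ c → δ-distinct v _ (λ v≡ → j≢i (only j (c , sym v≡))))))
          (trans (∑-cong (allVecs (dim i)) coefficient) (δ-sift (dim i) c₀ (λ _ → 1)))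
    where
    coefficient : ∀ c → δ v (lincomb c (basis i)) ≡ δ c c₀ * 1
    coefficient c = byCoefficient (c ≟ᵥ c₀)
      where
      byCoefficient : Dec (c ≡ c₀) → δ v (lincomb c (basis i)) ≡ δ c c₀ * 1
      byCoefficient (yes refl) = trans (cong (δ v) c₀↦v) (trans (δ-refl v) (sym (cong (_* 1) (δ-refl c))))
      byCoefficient (no c≢c₀) =
        trans (δ-distinct v _ (λ v≡ → c≢c₀ (lincomb-injective (basis i) (indep i) c c₀ (trans (sym v≡) (sym c₀↦v)))))
              (sym (cong (_* 1) (δ-distinct c c₀ c≢c₀)))

  ∑-over-partition : ∀ f → f 0ᵥ ≡ 0 → ∑ (allVecs N) f ≡ ∑ᶠ m (λ i → spanSum (basis i) f)
  ∑-over-partition f f0≡0 = sym (begin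
    ∑ᶠ m (λ i → spanSum (basis i) f)
      ≡⟨ ∑ᶠ-cong m (λ i → ∑-cong (allVecs (dim i)) (λ c → sym (δ-sift N (lincomb c (basis i)) f))) ⟩
    ∑ᶠ m (λ i → ∑ (allVecs (dim i)) (λ c → ∑ (allVecs N) (λ v → δ v (lincomb c (basis i)) * f v)))
      ≡⟨ ∑ᶠ-cong m (λ i → ∑-swap (allVecs (dim i)) (allVecs N) _) ⟩
    ∑ᶠ m (λ i → ∑ (allVecs N) (λ v → spanSum (basis i) (λ u → δ v u * f v)))
      ≡⟨ ∑ᶠ-∑-swap m (allVecs N) _ ⟩
    ∑ (allVecs N) (λ v → ∑ᶠ m (λ i → spanSum (basis i) (λ u → δ v u * f v)))
      ≡⟨ ∑-cong (allVecs N) counted-once ⟩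
    ∑ (allVecs N) f ∎)
    where
    open ≡-Reasoning
    counted-once : ∀ v → ∑ᶠ m (λ i → spanSum (basis i) (λ u → δ v u * f v)) ≡ f v
    counted-once v = trans (∑ᶠ-cong m (λ i → sym (∑-*ʳ (allVecs (dim i)) _ (f v))))
                           (trans (sym (∑ᶠ-*ʳ m _ (f v))) (byZero (v ≟ᵥ 0ᵥ)))
      where
      byZero : Dec (v ≡ 0ᵥ) → ∑ᶠ m (λ i → spanSum (basis i) (δ v)) * f v ≡ f v
      byZero (yes refl) = trans (cong (multiplicity *_) f0≡0) (trans (*-zeroʳ multiplicity) (sym f0≡0))
        where multiplicity = ∑ᶠ m (λ i → spanSum (basis i) (δ 0ᵥ))
      byZero (no v≢0) = trans (cong (_* f v) (multiplicity-one v v≢0)) (+-identityʳ _)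

generatorOf : ∀ {N} d → Vec (F2Vec N) d → List (F2Vec N)
generatorOf zero _ = []
generatorOf (suc zero) (v ∷ []) = v ∷ []
generatorOf (suc (suc _)) _ = []

points : ∀ {N} m (d : Fin m → ℕ) (B : (i : Fin m) → Vec (F2Vec N) (d i)) → List (F2Vec N)
points zero d B = []
points (suc m) d B = generatorOf (d zero) (B zero) ++ points m (d ∘ suc) (B ∘ suc)

length-generatorOf-1 : ∀ {N} d (v : Vec (F2Vec N) d) → d ≡ 1 → length (generatorOf d v) ≡ 1
length-generatorOf-1 (suc zero) (v ∷ []) refl = refl

length-generatorOf-≢1 : ∀ {N} d (v : Vec (F2Vec N) d) → d ≢ 1 → length (generatorOf d v) ≡ 0
length-generatorOf-≢1 zero v _ = refl
length-generatorOf-≢1 (suc zero) v d≢1 = ⊥-elim (d≢1 refl)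
length-generatorOf-≢1 (suc (suc d)) v _ = refl

length-points : ∀ {N} m (d : Fin m → ℕ) (B : (i : Fin m) → Vec (F2Vec N) (d i)) →
  length (points m d B) ≡ countDim d 1
length-points zero d B = refl
length-points (suc m) d B with d zero ≟ 1
... | yes d₀≡1 =
  trans (length-++ (generatorOf (d zero) (B zero))) (cong₂ _+_ (length-generatorOf-1 (d zero) (B zero) d₀≡1) (length-points m _ _))
... | no d₀≢1 =
  trans (length-++ (generatorOf (d zero) (B zero))) (cong₂ _+_ (length-generatorOf-≢1 (d zero) (B zero) d₀≢1) (length-points m _ _))

NontrivialCombination : ∀ {N d} → Vec (F2Vec N) d → F2Vec N → Set
NontrivialCombination {d = d} bs u = Σ (Vec Bool d) λ c → lincomb c bs ≡ u × c ≢ replicate d false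

nontrivial-nonzero : ∀ {N d} (bs : Vec (F2Vec N) d) → LinIndep bs → ∀ {u} → NontrivialCombination bs u → u ≢ 0ᵥ
nontrivial-nonzero bs indep (c , c↦u , c≢0) u≡0 = c≢0 (indep c (trans c↦u u≡0))

generatorOf-nontrivial : ∀ {N} d (B : Vec (F2Vec N) d) {u} → u ∈ generatorOf d B → NontrivialCombination B u
generatorOf-nontrivial (suc zero) (v ∷ []) (here refl) = true ∷ [] , generator v , λ ()
  where
  generator : ∀ {N} (v : F2Vec N) → (true ·ᵥ v) +ᵥ 0ᵥ ≡ v
  generator [] = refl
  generator (x ∷ v) = cong₂ _∷_ (xor-identityʳ x) (generator v)

points-nontrivial : ∀ {N} m (d : Fin m → ℕ) (B : (i : Fin m) → Vec (F2Vec N) (d i)) {u} →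
  u ∈ points m d B → Σ (Fin m) λ j → NontrivialCombination (B j) u
points-nontrivial (suc m) d B u∈ with ∈-++⁻ (generatorOf (d zero) (B zero)) u∈
... | inj₁ u∈₀ = zero , generatorOf-nontrivial (d zero) (B zero) u∈₀
... | inj₂ u∈rest = let (j , nt) = points-nontrivial m (d ∘ suc) (B ∘ suc) u∈rest in suc j , nt

points-nonzero : ∀ {N} m (d : Fin m → ℕ) (B : (i : Fin m) → Vec (F2Vec N) (d i)) →
  (∀ i → LinIndep (B i)) → All (_≢ 0ᵥ) (points m d B)
points-nonzero m d B indep =
  All.tabulate λ u∈ → let (j , nt) = points-nontrivial m d B u∈ in nontrivial-nonzero (B j) (indep j) nt

MeetTrivially : ∀ {N} m (d : Fin m → ℕ) (B : (i : Fin m) → Vec (F2Vec N) (d i)) → Set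
MeetTrivially m d B = ∀ v i j → v ≢ 0ᵥ → InSpan v (B i) → InSpan v (B j) → i ≡ j

-- Different members have different generators, since a generator lies in its own member only.
points-unique : ∀ {N} m (d : Fin m → ℕ) (B : (i : Fin m) → Vec (F2Vec N) (d i)) →
  (∀ i → LinIndep (B i)) → MeetTrivially m d B → Unique (points m d B)
points-unique zero d B indep meet = AllPairs.[]
points-unique (suc m) d B indep meet =
  Unique.++⁺ (generatorOf-unique (d zero) (B zero))
             (points-unique m (d ∘ suc) (B ∘ suc) (indep ∘ suc) (λ v i j v≢0 v∈i v∈j → suc-injective (meet v (suc i) (suc j) v≢0 v∈i v∈j)))
             disjoint
  where
  generatorOf-unique : ∀ d (v : Vec _ d) → Unique (generatorOf d v)
  generatorOf-unique zero v = AllPairs.[]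
  generatorOf-unique (suc zero) (v ∷ []) = [] AllPairs.∷ AllPairs.[]
  generatorOf-unique (suc (suc d)) v = AllPairs.[]
  disjoint : ∀ {v} → ¬ (v ∈ generatorOf (d zero) (B zero) × v ∈ points m (d ∘ suc) (B ∘ suc))
  disjoint (v∈₀ , v∈rest) with generatorOf-nontrivial (d zero) (B zero) v∈₀ | points-nontrivial m (d ∘ suc) (B ∘ suc) v∈rest
  ... | nt@(c , c↦v , _) | j , (c' , c'↦v , _) with meet _ zero (suc j) (nontrivial-nonzero (B zero) (indep zero) nt) (c , c↦v) (c' , c'↦v)
  ... | ()

spanSum-congruence : ∀ {N} e (a : F2Vec N) d (B : Vec (F2Vec N) d) → d ≡ 1 ⊎ e < d →
  Σ ℕ λ r → spanSum B (bit ∘ dot a) ≡ r * 2 ^ e + weight (generatorOf d B) a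
spanSum-congruence e a zero [] (inj₁ ())
spanSum-congruence e a zero [] (inj₂ ())
spanSum-congruence e a (suc zero) (u ∷ []) _ =
  0 , cong₂ (λ x y → bit x + (bit y + 0)) (dot-lincomb a (false ∷ []) (u ∷ [])) (trans (dot-lincomb a (true ∷ []) (u ∷ [])) (xor-identityʳ _))
spanSum-congruence e a (suc (suc d)) B (inj₂ e<d) with oddCount-divisible (Vec.map (dot a) B) e<d
... | divides r oddCount≡ =
  r , trans (∑-cong (allVecs (suc (suc d))) (λ c → cong bit (dot-lincomb a c B))) (trans oddCount≡ (sym (+-identityʳ _)))

points-congruence : ∀ {N} e (a : F2Vec N) m (d : Fin m → ℕ) (B : (i : Fin m) → Vec (F2Vec N) (d i)) →
  (∀ i → d i ≡ 1 ⊎ e < d i) →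
  Σ ℕ λ r → ∑ᶠ m (λ i → spanSum (B i) (bit ∘ dot a)) ≡ r * 2 ^ e + weight (points m d B) a
points-congruence e a zero d B dims = 0 , refl
points-congruence e a (suc m) d B dims
  with spanSum-congruence e a (d zero) (B zero) (dims zero) | points-congruence e a m (d ∘ suc) (B ∘ suc) (dims ∘ suc)
... | r₀ , first | r , rest =
  r₀ + r , trans (cong₂ _+_ first rest)
                 (trans (regroup r₀ r (2 ^ e) _ _) (cong ((r₀ + r) * 2 ^ e +_) (sym (∑-++ (generatorOf (d zero) (B zero)) _ _))))
  where
  regroup : ∀ r₀ r W x y → r₀ * W + x + (r * W + y) ≡ (r₀ + r) * W + (x + y)
  regroup = solve-∀

-- Both the whole
-- space and each large member pair to 1 with a multiple of 2ᵉ vectors.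
points-divisible : ∀ {N} e (P : VectorSpacePartition N) → e < N →
  let open VectorSpacePartition P in
  (∀ i → dim i ≡ 1 ⊎ e < dim i) → ∀ a → 2 ^ e ∣ weight (points m dim basis) a
points-divisible {N} e P e<N dims a = ∣m+n∣m⇒∣n (subst (2 ^ e ∣_) total (oddCount-divisible a e<N)) (n∣m*n r)
  where
  open VectorSpacePartition P
  congruence = points-congruence e a m dim basis dims
  r = proj₁ congruence
  total : oddCount a ≡ r * 2 ^ e + weight (points m dim basis) a
  total = trans (∑-cong (allVecs N) (λ v → cong bit (dot-comm v a)))
                (trans (∑-over-partition P (bit ∘ dot a) (cong bit (dot-zeroʳ a))) (proj₂ congruence))

-- For e ≥ 2 and e < N, no partition of F₂ᴺ into subspaces of dimension 1 or > e has
-- exactly 2ᵉ⁺¹ + 1 members of dimension 1: its points would form a 2ᵉ-divisible set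
-- of 2·2ᵉ + 1 distinct nonzero vectors.
no-partition-with-2^[e+1]+1-points : ∀ {N} e → 2 ≤ e → e < N → (P : VectorSpacePartition N) →
  let open VectorSpacePartition P in
  (∀ i → dim i ≡ 1 ⊎ e < dim i) → countDim dim 1 ≡ 1 + 2 ^ suc e → ⊥
no-partition-with-2^[e+1]+1-points {N} e 2≤e e<N P dims #points =
  NoDivisibleSet.contradiction N (2 ^ e) (points m dim basis) 2^e>2
    (trans (length-points m dim basis) #points)
    (points-nonzero m dim basis indep)
    (points-unique m dim basis indep (members-meet-trivially P))
    (points-divisible e P e<N dims)
  where
  open VectorSpacePartition P
  2^e>2 : 2 < 2 ^ e
  2^e>2 = <-≤-trans (s≤s (s≤s (s≤s z≤n))) (^-monoʳ-≤ 2 2≤e)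

-- Lemma 12: with k ≥ 4 the dimensions k, k - 1 and 1 fall under the previous result
-- for e = k - 2, and k - 2 < k(t + 1) + 1.
lemma12 : (t k : ℕ) → t ≥ 1 → k ≥ 4 →
    (nk : ℕ) → nk * (2 ^ k ∸ 1) ≡ 2 ^ (k * t + 2) + 2 ^ k ∸ 5 →
    ¬ (Σ (VectorSpacePartition (k * (t + 1) + 1)) λ P →
    HasType P ((k , nk) ∷ (k ∸ 1 , 2 ^ (k * t + 2) ∸ 3) ∷ (1 , 1 + 2 ^ (k ∸ 1)) ∷ []))
lemma12 t k@(suc (suc (suc (suc j)))) _ (s≤s (s≤s (s≤s (s≤s _)))) _ _ (P , dimensions , (_ ∷ _ ∷ #points ∷ [])) =
  no-partition-with-2^[e+1]+1-points e (s≤s (s≤s z≤n)) e<N P dims #points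
  where
  open VectorSpacePartition P
  e = suc (suc j)
  e<k : e < k
  e<k = n≤1+n (suc e)
  k≤k[t+1] : k ≤ k * (t + 1)
  k≤k[t+1] = subst (_≤ k * (t + 1)) (*-identityʳ k) (*-monoʳ-≤ k (m≤n+m 1 t))
  e<N : e < k * (t + 1) + 1
  e<N = ≤-trans e<k (≤-trans k≤k[t+1] (m≤m+n _ 1))
  dims : ∀ i → dim i ≡ 1 ⊎ e < dim i
  dims i with dimensions i
  ... | here dim≡k = inj₂ (subst (e <_) (sym dim≡k) e<k)
  ... | there (here dim≡k-1) = inj₂ (subst (e <_) (sym dim≡k-1) ≤-refl)
  ... | there (there (here dim≡1)) = inj₁ dim≡1
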